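{- Let $(G,u)$ and $(H,v)$ be rooted graphs. Then for any integers $g,j\ge 0$ and $h\ge 1$, \begin{align*} X_{S_j^{gh}(G,H)}&=\sum_{i=0}^{j}X_{P_i}\,X_{P^{g+h+j-i}(G,H)}-\sum_{i=1}^{j}X_{G^{g+i-1}}\,X_{H^{h+j-i}},\quad\text{and}\\ X_{S_{hj}^{g}(G)}&=\sum_{i=0}^{j}X_{P_i}\,X_{G^{g+j-i+h}}-\sum_{i=1}^{j}X_{P_{i+h}}\,X_{G^{g+j-i}}. \end{align*}
   Context: All graphs are finite simple graphs; $X_G=\sum_{\kappa}\prod_{v\in V(G)}x_{\kappa(v)}$ over proper colorings $\kappa:V(G)\to\{1,2,\dots\}$ is the chromatic symmetric function. $P_i$ is the path on $i$ vertices; $P_0$ is the empty graph with $X_{P_0}=1$. For rooted graphs $(G,u),(H,v)$ and $k\ge 0$, $P^k(G,H)$ is obtained from disjoint copies of $G,H$ by adding a path of length $k$ linking $u$ and $v$ (identifying them if $k=0$); the tailed graph is $G^k=P^k(G,K_1)$. For nonnegative integers $\tau_1,\tau_2,\tau_3$ and rooted graphs $(G_i,u_i)$, $S^{\tau_1\tau_2\tau_3}(G_1,G_2,G_3)$ is obtained from a spider with center $c$ and three legs (paths from $c$, otherwise disjoint) of lengths $\tau_1,\tau_2,\tau_3$ by identifying $u_i$ with the far end of the $i$-th leg (with $c$ if $\tau_i=0$). Notation: $S^{\tau_1\tau_2}_{\tau_3}(G_1,G_2)=S^{\tau_1\tau_2\tau_3}(G_1,G_2,K_1)$ and $S^{\tau_1}_{\tau_2\tau_3}(G_1)=S^{\tau_1\tau_2\tau_3}(G_1,K_1,K_1)$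 (legs ending in $K_1$ are bare paths). -}

module Defs where

open import Data.Nat as ℕ using (ℕ; zero; suc; _+_; _∸_)
open import Data.Fin as Fin using (Fin; zero; suc; toℕ; fromℕ; _↑ˡ_; _↑ʳ_; punchOut)
open import Data.Bool using (Bool; true; false; _∧_; _∨_; not; if_then_else_)
open import Data.Integer as ℤ using (ℤ)
open import Data.List using (List; []; _∷_; map; concatMap)
open import Relation.Binary.PropositionalEquality using (_≡_; sym)
open import Relation.Nullary using (yes; no; ¬_)
open import Relation.Nullary.Decidable using (⌊_⌋)
open import Data.Product using (_×_)

record Graph : Set where
  constructor mkGraph
  field
    n   : ℕ
    adj : Fin n → Fin n → Bool
open Graph public

IsSimple : Graph → Set
IsSimple G = (∀ u v → adj G u v ≡ adj G v u) × (∀ u → adj G u u ≡ false)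

record RGraph : Set where
  constructor rooted
  field
    graph : Graph
    root  : Fin (n graph)
open RGraph public

anyFin : ∀ k → (Fin k → Bool) → Bool
anyFin zero    p = false
anyFin (suc k) p = p zero ∨ anyFin k (λ i → p (suc i))

prodFin : ∀ k → (Fin k → ℤ) → ℤ
prodFin zero    f = ℤ.+ 1
prodFin (suc k) f = f zero ℤ.* prodFin k (λ i → f (suc i))

sumList : List ℤ → ℤ
sumList []       = ℤ.+ 0
sumList (a ∷ as) = a ℤ.+ sumList as

allFin : ∀ k → List (Fin k)
allFin zero    = []
allFin (suc k) = zero ∷ map suc (allFin k)

cons : ∀ {k m} → Fin m → (Fin k → Fin m) → Fin (suc k) → Fin m
cons c f zero    = c
cons c f (suc i) = f i

allFuns : ∀ k m → List (Fin k → Fin m)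
allFuns zero    m = (λ ()) ∷ []
allFuns (suc k) m = concatMap (λ c → map (cons c) (allFuns k m)) (allFin m)

-- Chromatic symmetric function, specialised to m variables x₁..xₘ
-- (x_{m+1} = x_{m+2} = ... = 0), evaluated at x : Fin m → ℤ:
--   X G m x = Σ_{κ : V → Fin m proper} Π_v x (κ v)

proper : (G : Graph) {m : ℕ} → (Fin (n G) → Fin m) → Bool
proper G κ = not (anyFin (n G) (λ u → anyFin (n G) (λ v →
               adj G u v ∧ ⌊ κ u Fin.≟ κ v ⌋)))

X : Graph → (m : ℕ) → (Fin m → ℤ) → ℤ
X G m x = sumList (map (λ κ → if proper G κ then prodFin (n G) (λ v → x (κ v)) else ℤ.+ 0)
                       (allFuns (n G) m))

K1 : Graph
K1 = mkGraph 1 (λ _ _ → false)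

K1r : RGraph
K1r = rooted K1 zero

P : ℕ → Graph
P i = mkGraph i (λ a b → ⌊ suc (toℕ a) ℕ.≟ toℕ b ⌋ ∨ ⌊ suc (toℕ b) ℕ.≟ toℕ a ⌋)

-- Gluing: disjoint union of A and B with vertex a ∈ A identified with b ∈ B.

record Glued (A B : Graph) : Set where
  field
    G   : Graph
    inl : Fin (n A) → Fin (n G)
    inr : Fin (n B) → Fin (n G)
open Glued public

inrF : ∀ {N q} → Fin N → (Fin q → Fin N) → Fin (suc q) → Fin (suc q) → Fin N
inrF a' sh b j with j Fin.≟ b
... | yes _   = a'
... | no j≢b = sh (punchOut {i = b} {j = j} (λ e → j≢b (sym e)))

glue : (A : Graph) → Fin (n A) → (B : Graph) → Fin (n B) → Glued A B
glue A a (mkGraph zero adjB) ()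
glue A a (mkGraph (suc q) adjB) b = record
  { G   = mkGraph N adjN
  ; inl = iL
  ; inr = iR
  }
  where
  N : ℕ
  N = n A + q
  iL : Fin (n A) → Fin N
  iL i = i ↑ˡ q
  iR : Fin (suc q) → Fin N
  iR = inrF (iL a) (n A ↑ʳ_) b
  adjN : Fin N → Fin N → Bool
  adjN x y =
    anyFin (n A) (λ i → anyFin (n A) (λ j →
      adj A i j ∧ ⌊ iL i Fin.≟ x ⌋ ∧ ⌊ iL j Fin.≟ y ⌋))
    ∨ anyFin (suc q) (λ i → anyFin (suc q) (λ j →
      adjB i j ∧ ⌊ iR i Fin.≟ x ⌋ ∧ ⌊ iR j Fin.≟ y ⌋))

-- P^k(G,H): path of length k (on k+1 vertices 0..k) linking u and v.

Pk : ℕ → RGraph → RGraph → Graph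
Pk k (rooted Gr u) (rooted Hr v) = G W2
  where
  W1 = glue Gr u (P (suc k)) zero
  W2 = glue (G W1) (inr W1 (fromℕ k)) Hr v

tail : RGraph → ℕ → Graph
tail G k = Pk k G K1r

-- Spider S^{τ1 τ2 τ3}(G1,G2,G3): three legs P(τᵢ+1) glued at their
-- vertex 0 (the centre c); the root of Gᵢ is identified with the far
-- end (vertex τᵢ) of the i-th leg.

S : ℕ → ℕ → ℕ → RGraph → RGraph → RGraph → Graph
S t1 t2 t3 (rooted G1 u1) (rooted G2 u2) (rooted G3 u3) = G W5
  where
  W1 = glue (P (suc t1)) zero (P (suc t2)) zero
  W2 = glue (G W1) (inl W1 zero) (P (suc t3)) zero
  e1 = inl W2 (inl W1 (fromℕ t1))
  e2 = inl W2 (inr W1 (fromℕ t2))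
  e3 = inr W2 (fromℕ t3)
  W3 = glue (G W2) e1 G1 u1
  W4 = glue (G W3) (inl W3 e2) G2 u2
  W5 = glue (G W4) (inl W4 (inl W3 e3)) G3 u3

-- S^{τ1τ2}_{τ3}(G1,G2) = S^{τ1τ2τ3}(G1,G2,K1)
S₂ : ℕ → ℕ → ℕ → RGraph → RGraph → Graph
S₂ t1 t2 t3 G1 G2 = S t1 t2 t3 G1 G2 K1r

-- S^{τ1}_{τ2τ3}(G1) = S^{τ1τ2τ3}(G1,K1,K1)
S₁ : ℕ → ℕ → ℕ → RGraph → Graph
S₁ t1 t2 t3 G1 = S t1 t2 t3 G1 K1r K1r

Σ₁ : ℕ → (ℕ → ℤ) → ℤ
Σ₁ zero    f = ℤ.+ 0
Σ₁ (suc j) f = Σ₁ j f ℤ.+ f (suc j)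

Σ₀ : ℕ → (ℕ → ℤ) → ℤ
Σ₀ j f = f 0 ℤ.+ Σ₁ j f

{-# OPTIONS --safe #-}
-- Evaluate X at m colours with weights x and write ⟨u⟩ = Σ_c x_c u(c) for u : Fin m → ℤ.
-- The root profile F_R(c) of a rooted graph R is the weighted count of proper colourings of R
-- whose root has colour c, the root's own weight x_c left out. Identifying vertices of two
-- graphs multiplies their profiles at that vertex, and hanging R at the end of a path of
-- length k turns F_R into T^k F_R, where (T u)(c) = Σ_{d ≠ c} x_d u(d) = ⟨u⟩ - x_c u(c).
-- A bare leg end has profile 1, so
--   X(S^{t₁t₂t₃}(R₁,R₂,R₃)) = ⟨T^{t₁}F₁ · T^{t₂}F₂ · T^{t₃}F₃⟩,   X(P^k(G,H)) = ⟨F_G · T^k F_H⟩,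
--   X(G^k) = ⟨F_G · T^k 1⟩,   X(P_{k+1}) = ⟨T^k 1⟩.
-- T is self-adjoint for (u, v) ↦ ⟨u v⟩, and moving one T from the third factor of ⟨a b e⟩
-- onto the second costs exactly ⟨e⟩⟨a b⟩ - ⟨b⟩⟨a e⟩. Moving the j copies of T on the bare leg
-- one at a time onto H (first identity) or onto G (second identity) and collecting these
-- corrections gives the two sums.

module Submission where

open import Defs
open import Data.Nat using (ℕ; _+_; _∸_; _≤_)
open import Data.Fin using (Fin)
open import Data.Integer using (ℤ; _-_; _*_)
open import Data.Product using (_×_)
open import Relation.Binary.PropositionalEquality using (_≡_)

open import Data.Bool using (Bool; true; false; _∧_; _∨_; not; if_then_else_; T)
open import Data.Bool.Properties using (T-∧; T-∨)
open import Data.Empty using (⊥-elim)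
open import Data.Fin as Fin using (zero; suc; toℕ; fromℕ; _↑ˡ_; _↑ʳ_; punchOut)
open import Data.Integer as ℤ using (0ℤ; 1ℤ)
import Data.Integer.Properties as ℤ
open import Data.Integer.Tactic.RingSolver using (solve-∀)
open import Data.List as List using (List; []; _∷_; map; concatMap)
open import Data.Nat as ℕ using (zero; suc)
import Data.Nat.Properties as ℕ
import Data.Fin.Properties as Fin
open import Data.Product using (_,_; ∃; ∃₂)
open import Data.Sum as Sum using (_⊎_; inj₁; inj₂; [_,_])
open import Function using (_∘_; _⇔_; mk⇔; Equivalence)
open import Relation.Binary.PropositionalEquality
  using (refl; sym; trans; cong; cong₂; subst; _≢_; _≗_; module ≡-Reasoning)
open import Relation.Nullary using (yes; no)
open import Relation.Nullary.Decidable using (⌊_⌋; toWitness; fromWitness)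

open ≡-Reasoning

module _ {A : Set} where

  ∑ : List A → (A → ℤ) → ℤ
  ∑ l f = sumList (map f l)

  ∑-cong : ∀ l {f g : A → ℤ} → (∀ a → f a ≡ g a) → ∑ l f ≡ ∑ l g
  ∑-cong []      f≗g = refl
  ∑-cong (a ∷ l) f≗g = cong₂ ℤ._+_ (f≗g a) (∑-cong l f≗g)

  ∑-zero : ∀ l → ∑ l (λ _ → 0ℤ) ≡ 0ℤ
  ∑-zero []      = refl
  ∑-zero (a ∷ l) = cong (ℤ._+_ 0ℤ) (∑-zero l)

  ∑-distrib-+ : ∀ l (f g : A → ℤ) → ∑ l (λ a → f a ℤ.+ g a) ≡ ∑ l f ℤ.+ ∑ l g
  ∑-distrib-+ []      f g = refl
  ∑-distrib-+ (a ∷ l) f g = trans (cong (ℤ._+_ (f a ℤ.+ g a)) (∑-distrib-+ l f g)) (swap (f a) (g a) _ _)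
    where swap : ∀ p q r s → (p ℤ.+ q) ℤ.+ (r ℤ.+ s) ≡ (p ℤ.+ r) ℤ.+ (q ℤ.+ s)
          swap = solve-∀

  ∑-distrib-- : ∀ l (f g : A → ℤ) → ∑ l (λ a → f a - g a) ≡ ∑ l f - ∑ l g
  ∑-distrib-- []      f g = refl
  ∑-distrib-- (a ∷ l) f g = trans (cong (ℤ._+_ (f a - g a)) (∑-distrib-- l f g)) (swap (f a) (g a) _ _)
    where swap : ∀ p q r s → (p - q) ℤ.+ (r - s) ≡ (p ℤ.+ r) - (q ℤ.+ s)
          swap = solve-∀

  *-distribˡ-∑ : ∀ l k (f : A → ℤ) → ∑ l (λ a → k * f a) ≡ k * ∑ l f
  *-distribˡ-∑ []      k f = sym (ℤ.*-zeroʳ k)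
  *-distribˡ-∑ (a ∷ l) k f =
    trans (cong (ℤ._+_ (k * f a)) (*-distribˡ-∑ l k f)) (sym (ℤ.*-distribˡ-+ k (f a) _))

  ∑-++ : ∀ xs ys (f : A → ℤ) → ∑ (xs List.++ ys) f ≡ ∑ xs f ℤ.+ ∑ ys f
  ∑-++ []       ys f = sym (ℤ.+-identityˡ _)
  ∑-++ (a ∷ xs) ys f = trans (cong (ℤ._+_ (f a)) (∑-++ xs ys f)) (sym (ℤ.+-assoc (f a) _ _))

module _ {A B : Set} where

  ∑-map : ∀ l (g : A → B) (f : B → ℤ) → ∑ (map g l) f ≡ ∑ l (f ∘ g)
  ∑-map []      g f = refl
  ∑-map (a ∷ l) g f = cong (ℤ._+_ (f (g a))) (∑-map l g f)

  ∑-concatMap : ∀ l (g : A → List B) (f : B → ℤ) → ∑ (concatMap g l) f ≡ ∑ l (λ a → ∑ (g a) f)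
  ∑-concatMap []      g f = refl
  ∑-concatMap (a ∷ l) g f = trans (∑-++ (g a) (concatMap g l) f) (cong (ℤ._+_ (∑ (g a) f)) (∑-concatMap l g f))

  ∑-comm : ∀ l₁ l₂ (f : A → B → ℤ) → ∑ l₁ (λ a → ∑ l₂ (f a)) ≡ ∑ l₂ (λ b → ∑ l₁ (λ a → f a b))
  ∑-comm []       l₂ f = sym (∑-zero l₂)
  ∑-comm (a ∷ l₁) l₂ f = trans (cong (ℤ._+_ (∑ l₂ (f a))) (∑-comm l₁ l₂ f))
                               (sym (∑-distrib-+ l₂ (f a) (λ b → ∑ l₁ (λ a → f a b))))

Σ₁-cong : ∀ j {f f′ : ℕ → ℤ} → (∀ i → f i ≡ f′ i) → Σ₁ j f ≡ Σ₁ j f′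
Σ₁-cong zero    f≗f′ = refl
Σ₁-cong (suc j) f≗f′ = cong₂ ℤ._+_ (Σ₁-cong j f≗f′) (f≗f′ (suc j))

Σ₀-cong : ∀ j {f f′ : ℕ → ℤ} → (∀ i → f i ≡ f′ i) → Σ₀ j f ≡ Σ₀ j f′
Σ₀-cong j f≗f′ = cong₂ ℤ._+_ (f≗f′ 0) (Σ₁-cong j f≗f′)

Σ₀-Σ₁-suc : ∀ j (f k : ℕ → ℤ) → Σ₀ (suc j) f - Σ₁ (suc j) k ≡ (Σ₀ j f - Σ₁ j k) ℤ.+ (f (suc j) - k (suc j))
Σ₀-Σ₁-suc j f k = regroup (f 0) (Σ₁ j f) (f (suc j)) (Σ₁ j k) (k (suc j))
  where regroup : ∀ a s b t c → (a ℤ.+ (s ℤ.+ b)) - (t ℤ.+ c) ≡ ((a ℤ.+ s) - t) ℤ.+ (b - c)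
        regroup = solve-∀

⟦_⟧ : Bool → ℤ
⟦ true  ⟧ = 1ℤ
⟦ false ⟧ = 0ℤ

⟦not-∨⟧ : ∀ a b → ⟦ not (a ∨ b) ⟧ ≡ ⟦ not a ⟧ * ⟦ not b ⟧
⟦not-∨⟧ true  b = refl
⟦not-∨⟧ false b = sym (ℤ.*-identityˡ ⟦ not b ⟧)

T-ext : ∀ {a b} → (T a → T b) → (T b → T a) → a ≡ b
T-ext {false} {false} _ _ = refl
T-ext {false} {true}  _ b⇒a = ⊥-elim (b⇒a _)
T-ext {true}  {false} a⇒b _ = ⊥-elim (a⇒b _)
T-ext {true}  {true}  _ _ = refl

T-anyFin : ∀ k (p : Fin k → Bool) → T (anyFin k p) ⇔ ∃ λ i → T (p i)
T-anyFin k p = mk⇔ (to k p) (λ (i , pᵢ) → from k p i pᵢ)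
  where
  to : ∀ k (p : Fin k → Bool) → T (anyFin k p) → ∃ λ i → T (p i)
  to (suc k) p t with Equivalence.to T-∨ t
  ... | inj₁ p₀ = zero , p₀
  ... | inj₂ t′ with to k (p ∘ suc) t′
  ...   | i , pᵢ = suc i , pᵢ
  from : ∀ k (p : Fin k → Bool) i → T (p i) → T (anyFin k p)
  from (suc k) p zero    p₀ = Equivalence.from T-∨ (inj₁ p₀)
  from (suc k) p (suc i) pᵢ = Equivalence.from T-∨ (inj₂ (from k (p ∘ suc) i pᵢ))

ℕ-⌊suc≟suc⌋ : ∀ a b → ⌊ suc a ℕ.≟ suc b ⌋ ≡ ⌊ a ℕ.≟ b ⌋
ℕ-⌊suc≟suc⌋ a b = T-ext (fromWitness ∘ ℕ.suc-injective ∘ toWitness) (fromWitness ∘ cong suc ∘ toWitness)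

Fin-⌊suc≟suc⌋ : ∀ {k} (c d : Fin k) → ⌊ Fin.suc c Fin.≟ suc d ⌋ ≡ ⌊ c Fin.≟ d ⌋
Fin-⌊suc≟suc⌋ c d = T-ext (fromWitness ∘ Fin.suc-injective ∘ toWitness) (fromWitness ∘ cong suc ∘ toWitness)

∑-allFin-suc : ∀ k (h : Fin (suc k) → ℤ) → ∑ (allFin (suc k)) h ≡ h zero ℤ.+ ∑ (allFin k) (h ∘ suc)
∑-allFin-suc k h = cong (ℤ._+_ (h zero)) (∑-map (allFin k) suc h)

∑-allFin-except : ∀ k (c : Fin k) (h : Fin k → ℤ) →
  ∑ (allFin k) (λ d → ⟦ not ⌊ c Fin.≟ d ⌋ ⟧ * h d) ≡ ∑ (allFin k) h - h c
∑-allFin-except (suc k) zero h = begin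
  ∑ (allFin (suc k)) (λ d → ⟦ not ⌊ zero Fin.≟ d ⌋ ⟧ * h d)
    ≡⟨ ∑-allFin-suc k (λ d → ⟦ not ⌊ zero Fin.≟ d ⌋ ⟧ * h d) ⟩
  0ℤ * h zero ℤ.+ ∑ (allFin k) (λ d → 1ℤ * h (suc d))
    ≡⟨ cong (ℤ._+_ (0ℤ * h zero)) (∑-cong (allFin k) (λ d → ℤ.*-identityˡ (h (suc d)))) ⟩
  0ℤ * h zero ℤ.+ ∑ (allFin k) (h ∘ suc)
    ≡⟨ regroup (h zero) _ ⟩
  h zero ℤ.+ ∑ (allFin k) (h ∘ suc) - h zero
    ≡⟨ cong (_- h zero) (sym (∑-allFin-suc k h)) ⟩
  ∑ (allFin (suc k)) h - h zero ∎
  where regroup : ∀ a s → 0ℤ * a ℤ.+ s ≡ a ℤ.+ s - a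
        regroup = solve-∀
∑-allFin-except (suc k) (suc c) h = begin
  ∑ (allFin (suc k)) (λ d → ⟦ not ⌊ suc c Fin.≟ d ⌋ ⟧ * h d)
    ≡⟨ ∑-allFin-suc k (λ d → ⟦ not ⌊ suc c Fin.≟ d ⌋ ⟧ * h d) ⟩
  1ℤ * h zero ℤ.+ ∑ (allFin k) (λ d → ⟦ not ⌊ suc c Fin.≟ suc d ⌋ ⟧ * h (suc d))
    ≡⟨ cong (ℤ._+_ (1ℤ * h zero)) (∑-cong (allFin k) (λ d →
         cong (λ b → ⟦ not b ⟧ * h (suc d)) (Fin-⌊suc≟suc⌋ c d))) ⟩
  1ℤ * h zero ℤ.+ ∑ (allFin k) (λ d → ⟦ not ⌊ c Fin.≟ d ⌋ ⟧ * h (suc d))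
    ≡⟨ cong (ℤ._+_ (1ℤ * h zero)) (∑-allFin-except k c (h ∘ suc)) ⟩
  1ℤ * h zero ℤ.+ (∑ (allFin k) (h ∘ suc) - h (suc c))
    ≡⟨ regroup (h zero) _ (h (suc c)) ⟩
  h zero ℤ.+ ∑ (allFin k) (h ∘ suc) - h (suc c)
    ≡⟨ cong (_- h (suc c)) (sym (∑-allFin-suc k h)) ⟩
  ∑ (allFin (suc k)) h - h (suc c) ∎
  where regroup : ∀ a s b → 1ℤ * a ℤ.+ (s - b) ≡ a ℤ.+ s - b
        regroup = solve-∀

improper : (G : Graph) {m : ℕ} → (Fin (n G) → Fin m) → Bool
improper G κ = anyFin (n G) (λ u → anyFin (n G) (λ v → adj G u v ∧ ⌊ κ u Fin.≟ κ v ⌋))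

Clash : (G : Graph) {m : ℕ} → (Fin (n G) → Fin m) → Set
Clash G κ = ∃₂ λ u v → T (adj G u v) × κ u ≡ κ v

T-improper : ∀ G {m} (κ : Fin (n G) → Fin m) → T (improper G κ) ⇔ Clash G κ
T-improper G κ = mk⇔ to from
  where
  to : T (improper G κ) → Clash G κ
  to t with Equivalence.to (T-anyFin (n G) _) t
  ... | u , t′ with Equivalence.to (T-anyFin (n G) _) t′
  ...   | v , t″ with Equivalence.to T-∧ t″
  ...     | uv , same = u , v , uv , toWitness same
  from : Clash G κ → T (improper G κ)
  from (u , v , uv , κu≡κv) =
    Equivalence.from (T-anyFin (n G) _) (u , Equivalence.from (T-anyFin (n G) _)
      (v , Equivalence.from T-∧ (uv , fromWitness κu≡κv)))

proper-cong : ∀ G {m} {κ κ′ : Fin (n G) → Fin m} → κ ≗ κ′ → proper G κ ≡ proper G κ′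
proper-cong G κ≗κ′ = cong not (T-ext (clash-to-T κ≗κ′) (clash-to-T (sym ∘ κ≗κ′)))
  where
  clash-to-T : ∀ {κ κ′ : Fin (n G) → Fin _} → κ ≗ κ′ → T (improper G κ) → T (improper G κ′)
  clash-to-T κ≗κ′ t with Equivalence.to (T-improper G _) t
  ... | u , v , uv , κu≡κv =
    Equivalence.from (T-improper G _) (u , v , uv , trans (sym (κ≗κ′ u)) (trans κu≡κv (κ≗κ′ v)))

imageEdge : ∀ {k N} → (Fin k → Fin k → Bool) → (Fin k → Fin N) → Fin N → Fin N → Bool
imageEdge {k} a ι u v = anyFin k (λ i → anyFin k (λ j → a i j ∧ ⌊ ι i Fin.≟ u ⌋ ∧ ⌊ ι j Fin.≟ v ⌋))

T-imageEdge : ∀ {k N} (a : Fin k → Fin k → Bool) (ι : Fin k → Fin N) (u v : Fin N) →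
  T (imageEdge a ι u v) ⇔ ∃₂ λ i j → T (a i j) × ι i ≡ u × ι j ≡ v
T-imageEdge {k} a ι u v = mk⇔ to from
  where
  to : T (imageEdge a ι u v) → ∃₂ λ i j → T (a i j) × ι i ≡ u × ι j ≡ v
  to t with Equivalence.to (T-anyFin k _) t
  ... | i , t′ with Equivalence.to (T-anyFin k _) t′
  ...   | j , t″ with Equivalence.to (T-∧ {a i j}) t″
  ...     | aij , t‴ with Equivalence.to (T-∧ {⌊ ι i Fin.≟ u ⌋}) t‴
  ...       | ιi≡u , ιj≡v = i , j , aij , toWitness ιi≡u , toWitness ιj≡v
  from : (∃₂ λ i j → T (a i j) × ι i ≡ u × ι j ≡ v) → T (imageEdge a ι u v)
  from (i , j , aij , ιi≡u , ιj≡v) =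
    Equivalence.from (T-anyFin k _) (i , Equivalence.from (T-anyFin k _) (j ,
      Equivalence.from (T-∧ {a i j}) (aij ,
        Equivalence.from (T-∧ {⌊ ι i Fin.≟ u ⌋}) (fromWitness ιi≡u , fromWitness ιj≡v))))

≡∨-from-⇔ : ∀ {a b c : Bool} {A B C : Set} → T a ⇔ A → T b ⇔ B → T c ⇔ C →
  (A → B ⊎ C) → (B ⊎ C → A) → a ≡ b ∨ c
≡∨-from-⇔ {b = b} a⇔A b⇔B c⇔C A⇒B⊎C B⊎C⇒A = T-ext
  (λ ta → Equivalence.from (T-∨ {b}) (Sum.map (Equivalence.from b⇔B) (Equivalence.from c⇔C)
                                         (A⇒B⊎C (Equivalence.to a⇔A ta))))
  (λ tbc → Equivalence.from a⇔A (B⊎C⇒A (Sum.map (Equivalence.to b⇔B) (Equivalence.to c⇔C)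
                                         (Equivalence.to (T-∨ {b}) tbc))))

improper-glue : ∀ A a B b {m} (κ : Fin (n (G (glue A a B b))) → Fin m) →
  improper (G (glue A a B b)) κ ≡ improper A (κ ∘ inl (glue A a B b)) ∨ improper B (κ ∘ inr (glue A a B b))
improper-glue A a (mkGraph zero _) ()
improper-glue A a B@(mkGraph (suc q) adjB) b κ =
  ≡∨-from-⇔ (T-improper (G W) κ) (T-improper A (κ ∘ inl W)) (T-improper B (κ ∘ inr W))
            split [ clash-inl , clash-inr ]
  where
  W = glue A a B b

  pullback : ∀ (H : Graph) (ι : Fin (n H) → Fin (n (G W))) {u v} →
    (∃₂ λ i j → T (adj H i j) × ι i ≡ u × ι j ≡ v) → κ u ≡ κ v → Clash H (κ ∘ ι)
  pullback H ι (i , j , ij , refl , refl) κu≡κv = i , j , ij , κu≡κv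

  split : Clash (G W) κ → Clash A (κ ∘ inl W) ⊎ Clash B (κ ∘ inr W)
  split (u , v , uv , same) =
    Sum.map (λ inA → pullback A (inl W) (Equivalence.to (T-imageEdge (adj A) (inl W) u v) inA) same)
            (λ inB → pullback B (inr W) (Equivalence.to (T-imageEdge adjB (inr W) u v) inB) same)
            (Equivalence.to (T-∨ {imageEdge (adj A) (inl W) u v}) uv)

  clash-inl : Clash A (κ ∘ inl W) → Clash (G W) κ
  clash-inl (i , j , ij , same) = inl W i , inl W j , edge , same
    where edge = Equivalence.from (T-∨ {imageEdge (adj A) (inl W) (inl W i) (inl W j)})
                   (inj₁ (Equivalence.from (T-imageEdge (adj A) (inl W) _ _) (i , j , ij , refl , refl)))

  clash-inr : Clash B (κ ∘ inr W) → Clash (G W) κ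
  clash-inr (i , j , ij , same) = inr W i , inr W j , edge , same
    where edge = Equivalence.from (T-∨ {imageEdge (adj A) (inl W) (inr W i) (inr W j)})
                   (inj₂ (Equivalence.from (T-imageEdge adjB (inr W) _ _) (i , j , ij , refl , refl)))

path-adj-suc : ∀ k u v → adj (P (suc (suc k))) (suc u) (suc v) ≡ adj (P (suc k)) u v
path-adj-suc k u v = cong₂ _∨_ (ℕ-⌊suc≟suc⌋ (suc (toℕ u)) (toℕ v)) (ℕ-⌊suc≟suc⌋ (suc (toℕ v)) (toℕ u))

improper-path : ∀ k {m} (κ : Fin (suc (suc k)) → Fin m) →
  improper (P (suc (suc k))) κ ≡ ⌊ κ zero Fin.≟ κ (suc zero) ⌋ ∨ improper (P (suc k)) (κ ∘ suc)
improper-path k κ =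
  ≡∨-from-⇔ (T-improper (P (suc (suc k))) κ) (mk⇔ (toWitness {a? = ends?}) fromWitness)
            (T-improper (P (suc k)) (κ ∘ suc))
            split [ clash-ends , clash-suc ]
  where
  ends? = κ zero Fin.≟ κ (suc zero)

  split : Clash (P (suc (suc k))) κ → κ zero ≡ κ (suc zero) ⊎ Clash (P (suc k)) (κ ∘ suc)
  split (zero , suc zero , _ , same)  = inj₁ same
  split (suc zero , zero , _ , same)  = inj₁ (sym same)
  split (suc u , suc v , uv , same)   = inj₂ (u , v , subst T (path-adj-suc k u v) uv , same)
  split (zero , zero , () , _)
  split (zero , suc (suc v) , () , _)
  split (suc (suc u) , zero , () , _)

  clash-ends : κ zero ≡ κ (suc zero) → Clash (P (suc (suc k))) κ
  clash-ends same = zero , suc zero , _ , same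

  clash-suc : Clash (P (suc k)) (κ ∘ suc) → Clash (P (suc (suc k))) κ
  clash-suc (u , v , uv , same) = suc u , suc v , subst T (sym (path-adj-suc k u v)) uv , same

⟦proper-glue⟧ : ∀ A a B b {m} (κ : Fin (n (G (glue A a B b))) → Fin m) →
  ⟦ proper (G (glue A a B b)) κ ⟧ ≡ ⟦ proper A (κ ∘ inl (glue A a B b)) ⟧ * ⟦ proper B (κ ∘ inr (glue A a B b)) ⟧
⟦proper-glue⟧ A a B b κ = trans (cong (⟦_⟧ ∘ not) (improper-glue A a B b κ))
  (⟦not-∨⟧ (improper A (κ ∘ inl (glue A a B b))) (improper B (κ ∘ inr (glue A a B b))))

⟦proper-path⟧ : ∀ k {m} (κ : Fin (suc (suc k)) → Fin m) →
  ⟦ proper (P (suc (suc k))) κ ⟧ ≡ ⟦ not ⌊ κ zero Fin.≟ κ (suc zero) ⌋ ⟧ * ⟦ proper (P (suc k)) (κ ∘ suc) ⟧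
⟦proper-path⟧ k κ = trans (cong (⟦_⟧ ∘ not) (improper-path k κ))
  (⟦not-∨⟧ ⌊ κ zero Fin.≟ κ (suc zero) ⌋ (improper (P (suc k)) (κ ∘ suc)))

module ColourFunctions (m : ℕ) (x : Fin m → ℤ) where

  ∑ᶜ : (Fin m → ℤ) → ℤ
  ∑ᶜ = ∑ (allFin m)

  ⟨_⟩ : (Fin m → ℤ) → ℤ
  ⟨ u ⟩ = ∑ᶜ (λ c → x c * u c)

  infixl 7 _⊙_
  _⊙_ : (Fin m → ℤ) → (Fin m → ℤ) → Fin m → ℤ
  (u ⊙ v) c = u c * v c

  one : Fin m → ℤ
  one _ = 1ℤ

  extend : (Fin m → ℤ) → Fin m → ℤ
  extend u c = ⟨ u ⟩ - x c * u c

  extend^ : ℕ → (Fin m → ℤ) → Fin m → ℤ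
  extend^ zero    u = u
  extend^ (suc k) u = extend (extend^ k u)

  XPath : ℕ → ℤ
  XPath zero    = 1ℤ
  XPath (suc k) = ⟨ extend^ k one ⟩

  ⟨⟩-cong : ∀ {u v} → u ≗ v → ⟨ u ⟩ ≡ ⟨ v ⟩
  ⟨⟩-cong u≗v = ∑-cong (allFin m) (λ c → cong (x c *_) (u≗v c))

  ⟨⊙⟩-comm : ∀ u v → ⟨ u ⊙ v ⟩ ≡ ⟨ v ⊙ u ⟩
  ⟨⊙⟩-comm u v = ⟨⟩-cong (λ c → ℤ.*-comm (u c) (v c))

  ⟨one⊙⟩ : ∀ u → ⟨ one ⊙ u ⟩ ≡ ⟨ u ⟩
  ⟨one⊙⟩ u = ⟨⟩-cong (λ c → ℤ.*-identityˡ (u c))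

  ⟨⊙one⟩ : ∀ u → ⟨ u ⊙ one ⟩ ≡ ⟨ u ⟩
  ⟨⊙one⟩ u = ⟨⟩-cong (λ c → ℤ.*-identityʳ (u c))

  ⟨⊙extend⟩ : ∀ u v → ⟨ u ⊙ extend v ⟩ ≡ ⟨ v ⟩ * ⟨ u ⟩ - ⟨ x ⊙ u ⊙ v ⟩
  ⟨⊙extend⟩ u v = begin
    ∑ᶜ (λ c → x c * (u c * (⟨ v ⟩ - x c * v c)))
      ≡⟨ ∑-cong (allFin m) (λ c → expand (x c) (u c) (v c) ⟨ v ⟩) ⟩
    ∑ᶜ (λ c → ⟨ v ⟩ * (x c * u c) - x c * (x c * u c * v c))
      ≡⟨ ∑-distrib-- (allFin m) _ _ ⟩
    ∑ᶜ (λ c → ⟨ v ⟩ * (x c * u c)) - ⟨ x ⊙ u ⊙ v ⟩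
      ≡⟨ cong (_- ⟨ x ⊙ u ⊙ v ⟩) (*-distribˡ-∑ (allFin m) ⟨ v ⟩ _) ⟩
    ⟨ v ⟩ * ⟨ u ⟩ - ⟨ x ⊙ u ⊙ v ⟩ ∎
    where expand : ∀ xc uc vc s → xc * (uc * (s - xc * vc)) ≡ s * (xc * uc) - xc * (xc * uc * vc)
          expand = solve-∀

  ⟨⊙⊙⟩-swap : ∀ a b e → ⟨ a ⊙ b ⊙ e ⟩ ≡ ⟨ a ⊙ e ⊙ b ⟩
  ⟨⊙⊙⟩-swap a b e = ⟨⟩-cong (λ c → swap (a c) (b c) (e c))
    where swap : ∀ p q r → p * q * r ≡ p * r * q
          swap = solve-∀

  extend-selfAdjoint : ∀ u v → ⟨ u ⊙ extend v ⟩ ≡ ⟨ extend u ⊙ v ⟩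
  extend-selfAdjoint u v = begin
    ⟨ u ⊙ extend v ⟩               ≡⟨ ⟨⊙extend⟩ u v ⟩
    ⟨ v ⟩ * ⟨ u ⟩ - ⟨ x ⊙ u ⊙ v ⟩  ≡⟨ cong₂ _-_ (ℤ.*-comm ⟨ v ⟩ ⟨ u ⟩) (⟨⊙⊙⟩-swap x u v) ⟩
    ⟨ u ⟩ * ⟨ v ⟩ - ⟨ x ⊙ v ⊙ u ⟩  ≡⟨ sym (⟨⊙extend⟩ v u) ⟩
    ⟨ v ⊙ extend u ⟩               ≡⟨ ⟨⊙⟩-comm v (extend u) ⟩
    ⟨ extend u ⊙ v ⟩               ∎

  extend^-adjoint : ∀ g h u v → ⟨ extend^ g u ⊙ extend^ h v ⟩ ≡ ⟨ u ⊙ extend^ (g + h) v ⟩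
  extend^-adjoint zero    h u v = refl
  extend^-adjoint (suc g) h u v = begin
    ⟨ extend (extend^ g u) ⊙ extend^ h v ⟩  ≡⟨ sym (extend-selfAdjoint (extend^ g u) (extend^ h v)) ⟩
    ⟨ extend^ g u ⊙ extend^ (suc h) v ⟩     ≡⟨ extend^-adjoint g (suc h) u v ⟩
    ⟨ u ⊙ extend^ (g + suc h) v ⟩           ≡⟨ cong (λ k → ⟨ u ⊙ extend^ k v ⟩) (ℕ.+-suc g h) ⟩
    ⟨ u ⊙ extend^ (suc g + h) v ⟩           ∎

  ⟨extend^⟩ : ∀ h u → ⟨ extend^ h u ⟩ ≡ ⟨ u ⊙ extend^ h one ⟩
  ⟨extend^⟩ h u = begin
    ⟨ extend^ h u ⟩                ≡⟨ sym (⟨⊙one⟩ (extend^ h u)) ⟩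
    ⟨ extend^ h u ⊙ extend^ 0 one ⟩ ≡⟨ extend^-adjoint h 0 u one ⟩
    ⟨ u ⊙ extend^ (h + 0) one ⟩    ≡⟨ cong (λ k → ⟨ u ⊙ extend^ k one ⟩) (ℕ.+-identityʳ h) ⟩
    ⟨ u ⊙ extend^ h one ⟩          ∎

  shift-extend₂ : ∀ a b e →
    ⟨ a ⊙ b ⊙ extend e ⟩ ≡ ⟨ a ⊙ extend b ⊙ e ⟩ ℤ.+ (⟨ e ⟩ * ⟨ a ⊙ b ⟩ - ⟨ b ⟩ * ⟨ a ⊙ e ⟩)
  shift-extend₂ a b e = begin
    ⟨ a ⊙ b ⊙ extend e ⟩
      ≡⟨ ⟨⊙extend⟩ (a ⊙ b) e ⟩
    ⟨ e ⟩ * ⟨ a ⊙ b ⟩ - ⟨ x ⊙ (a ⊙ b) ⊙ e ⟩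
      ≡⟨ cong (λ q → ⟨ e ⟩ * ⟨ a ⊙ b ⟩ - q) (⟨⟩-cong (λ c → swap (x c) (a c) (b c) (e c))) ⟩
    ⟨ e ⟩ * ⟨ a ⊙ b ⟩ - ⟨ x ⊙ (a ⊙ e) ⊙ b ⟩
      ≡⟨ regroup (⟨ e ⟩ * ⟨ a ⊙ b ⟩) (⟨ b ⟩ * ⟨ a ⊙ e ⟩) ⟨ x ⊙ (a ⊙ e) ⊙ b ⟩ ⟩
    (⟨ b ⟩ * ⟨ a ⊙ e ⟩ - ⟨ x ⊙ (a ⊙ e) ⊙ b ⟩) ℤ.+ D
      ≡⟨ cong (λ t → t ℤ.+ D) (sym (trans (⟨⊙⊙⟩-swap a (extend b) e) (⟨⊙extend⟩ (a ⊙ e) b))) ⟩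
    ⟨ a ⊙ extend b ⊙ e ⟩ ℤ.+ D ∎
    where
    D = ⟨ e ⟩ * ⟨ a ⊙ b ⟩ - ⟨ b ⟩ * ⟨ a ⊙ e ⟩
    swap : ∀ xc ac bc ec → xc * (ac * bc) * ec ≡ xc * (ac * ec) * bc
    swap = solve-∀
    regroup : ∀ p q r → p - r ≡ (q - r) ℤ.+ (p - q)
    regroup = solve-∀

  shift-extend₁ : ∀ a b e →
    ⟨ a ⊙ b ⊙ extend e ⟩ ≡ ⟨ extend a ⊙ b ⊙ e ⟩ ℤ.+ (⟨ e ⟩ * ⟨ a ⊙ b ⟩ - ⟨ a ⟩ * ⟨ b ⊙ e ⟩)
  shift-extend₁ a b e = begin
    ⟨ a ⊙ b ⊙ extend e ⟩
      ≡⟨ ⟨⟩-cong (λ c → cong (_* extend e c) (ℤ.*-comm (a c) (b c))) ⟩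
    ⟨ b ⊙ a ⊙ extend e ⟩
      ≡⟨ shift-extend₂ b a e ⟩
    ⟨ b ⊙ extend a ⊙ e ⟩ ℤ.+ (⟨ e ⟩ * ⟨ b ⊙ a ⟩ - ⟨ a ⟩ * ⟨ b ⊙ e ⟩)
      ≡⟨ cong₂ (λ t s → t ℤ.+ (⟨ e ⟩ * s - ⟨ a ⟩ * ⟨ b ⊙ e ⟩))
               (⟨⟩-cong (λ c → cong (_* e c) (ℤ.*-comm (b c) (extend a c)))) (⟨⊙⟩-comm b a) ⟩
    ⟨ extend a ⊙ b ⊙ e ⟩ ℤ.+ (⟨ e ⟩ * ⟨ a ⊙ b ⟩ - ⟨ a ⟩ * ⟨ b ⊙ e ⟩) ∎

  spider-expansion₁ : ∀ (F H : Fin m → ℤ) g j h →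
    ⟨ extend^ g F ⊙ extend^ h H ⊙ extend^ j one ⟩
      ≡ Σ₀ j (λ i → XPath i * ⟨ F ⊙ extend^ (g + h + j ∸ i) H ⟩)
        - Σ₁ j (λ i → ⟨ F ⊙ extend^ (g + i ∸ 1) one ⟩ * ⟨ H ⊙ extend^ (h + j ∸ i) one ⟩)
  spider-expansion₁ F H g zero h = begin
    ⟨ extend^ g F ⊙ extend^ h H ⊙ one ⟩  ≡⟨ ⟨⊙one⟩ (extend^ g F ⊙ extend^ h H) ⟩
    ⟨ extend^ g F ⊙ extend^ h H ⟩        ≡⟨ extend^-adjoint g h F H ⟩
    ⟨ F ⊙ extend^ (g + h) H ⟩            ≡⟨ cong (λ k → ⟨ F ⊙ extend^ k H ⟩) (sym (ℕ.+-identityʳ (g + h))) ⟩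
    ⟨ F ⊙ extend^ (g + h + 0) H ⟩        ≡⟨ pad _ ⟩
    (1ℤ * ⟨ F ⊙ extend^ (g + h + 0) H ⟩ ℤ.+ 0ℤ) - 0ℤ ∎
    where pad : ∀ p → p ≡ (1ℤ * p ℤ.+ 0ℤ) - 0ℤ
          pad = solve-∀
  spider-expansion₁ F H g (suc j) h = begin
    ⟨ a ⊙ b ⊙ extend e ⟩
      ≡⟨ shift-extend₂ a b e ⟩
    ⟨ a ⊙ extend b ⊙ e ⟩ ℤ.+ (⟨ e ⟩ * ⟨ a ⊙ b ⟩ - ⟨ b ⟩ * ⟨ a ⊙ e ⟩)
      ≡⟨ cong₂ ℤ._+_ (spider-expansion₁ F H g j (suc h)) (cong₂ (λ p q → ⟨ e ⟩ * p - q) last-f last-k) ⟩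
    (Σ₀ j f′ - Σ₁ j k′) ℤ.+ (f (suc j) - k (suc j))
      ≡⟨ cong (λ t → t ℤ.+ (f (suc j) - k (suc j))) (cong₂ _-_ (Σ₀-cong j shift-f) (Σ₁-cong j shift-k)) ⟩
    (Σ₀ j f - Σ₁ j k) ℤ.+ (f (suc j) - k (suc j))
      ≡⟨ sym (Σ₀-Σ₁-suc j f k) ⟩
    Σ₀ (suc j) f - Σ₁ (suc j) k ∎
    where
    a = extend^ g F
    b = extend^ h H
    e = extend^ j one
    f f′ k k′ : ℕ → ℤ
    f  i = XPath i * ⟨ F ⊙ extend^ (g + h + suc j ∸ i) H ⟩
    f′ i = XPath i * ⟨ F ⊙ extend^ (g + suc h + j ∸ i) H ⟩
    k  i = ⟨ F ⊙ extend^ (g + i ∸ 1) one ⟩ * ⟨ H ⊙ extend^ (h + suc j ∸ i) one ⟩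
    k′ i = ⟨ F ⊙ extend^ (g + i ∸ 1) one ⟩ * ⟨ H ⊙ extend^ (suc h + j ∸ i) one ⟩
    shift-f : ∀ i → f′ i ≡ f i
    shift-f i = cong (λ n → XPath i * ⟨ F ⊙ extend^ (n ∸ i) H ⟩)
                     (trans (cong (_+ j) (ℕ.+-suc g h)) (sym (ℕ.+-suc (g + h) j)))
    shift-k : ∀ i → k′ i ≡ k i
    shift-k i = cong (λ n → ⟨ F ⊙ extend^ (g + i ∸ 1) one ⟩ * ⟨ H ⊙ extend^ (n ∸ i) one ⟩)
                     (sym (ℕ.+-suc h j))
    last-f : ⟨ a ⊙ b ⟩ ≡ ⟨ F ⊙ extend^ (g + h + suc j ∸ suc j) H ⟩
    last-f = trans (extend^-adjoint g h F H)
                   (cong (λ n → ⟨ F ⊙ extend^ n H ⟩) (sym (ℕ.m+n∸n≡m (g + h) (suc j))))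
    last-k : ⟨ b ⟩ * ⟨ a ⊙ e ⟩ ≡ k (suc j)
    last-k = begin
      ⟨ b ⟩ * ⟨ a ⊙ e ⟩
        ≡⟨ cong₂ _*_ (⟨extend^⟩ h H) (extend^-adjoint g j F one) ⟩
      ⟨ H ⊙ extend^ h one ⟩ * ⟨ F ⊙ extend^ (g + j) one ⟩
        ≡⟨ ℤ.*-comm ⟨ H ⊙ extend^ h one ⟩ ⟨ F ⊙ extend^ (g + j) one ⟩ ⟩
      ⟨ F ⊙ extend^ (g + j) one ⟩ * ⟨ H ⊙ extend^ h one ⟩
        ≡⟨ cong₂ (λ p q → ⟨ F ⊙ extend^ p one ⟩ * ⟨ H ⊙ extend^ q one ⟩)
                 (sym (cong (_∸ 1) (ℕ.+-suc g j))) (sym (ℕ.m+n∸n≡m h (suc j))) ⟩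
      k (suc j) ∎

  spider-expansion₂ : ∀ (F : Fin m → ℤ) g j h →
    ⟨ extend^ g F ⊙ extend^ h one ⊙ extend^ j one ⟩
      ≡ Σ₀ j (λ i → XPath i * ⟨ F ⊙ extend^ (g + j ∸ i + h) one ⟩)
        - Σ₁ j (λ i → XPath (i + h) * ⟨ F ⊙ extend^ (g + j ∸ i) one ⟩)
  spider-expansion₂ F g zero h = begin
    ⟨ extend^ g F ⊙ extend^ h one ⊙ one ⟩  ≡⟨ ⟨⊙one⟩ (extend^ g F ⊙ extend^ h one) ⟩
    ⟨ extend^ g F ⊙ extend^ h one ⟩        ≡⟨ extend^-adjoint g h F one ⟩
    ⟨ F ⊙ extend^ (g + h) one ⟩            ≡⟨ cong (λ k → ⟨ F ⊙ extend^ (k + h) one ⟩) (sym (ℕ.+-identityʳ g)) ⟩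
    ⟨ F ⊙ extend^ (g + 0 + h) one ⟩        ≡⟨ pad _ ⟩
    (1ℤ * ⟨ F ⊙ extend^ (g + 0 + h) one ⟩ ℤ.+ 0ℤ) - 0ℤ ∎
    where pad : ∀ p → p ≡ (1ℤ * p ℤ.+ 0ℤ) - 0ℤ
          pad = solve-∀
  spider-expansion₂ F g (suc j) h = begin
    ⟨ a ⊙ b ⊙ extend e ⟩
      ≡⟨ shift-extend₁ a b e ⟩
    ⟨ extend a ⊙ b ⊙ e ⟩ ℤ.+ (⟨ e ⟩ * ⟨ a ⊙ b ⟩ - ⟨ a ⟩ * ⟨ b ⊙ e ⟩)
      ≡⟨ cong₂ ℤ._+_ (spider-expansion₂ F (suc g) j h) (cong₂ (λ p q → ⟨ e ⟩ * p - q) last-f last-k) ⟩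
    (Σ₀ j f′ - Σ₁ j k′) ℤ.+ (f (suc j) - k (suc j))
      ≡⟨ cong (λ t → t ℤ.+ (f (suc j) - k (suc j))) (cong₂ _-_ (Σ₀-cong j shift-f) (Σ₁-cong j shift-k)) ⟩
    (Σ₀ j f - Σ₁ j k) ℤ.+ (f (suc j) - k (suc j))
      ≡⟨ sym (Σ₀-Σ₁-suc j f k) ⟩
    Σ₀ (suc j) f - Σ₁ (suc j) k ∎
    where
    a = extend^ g F
    b = extend^ h one
    e = extend^ j one
    f f′ k k′ : ℕ → ℤ
    f  i = XPath i * ⟨ F ⊙ extend^ (g + suc j ∸ i + h) one ⟩
    f′ i = XPath i * ⟨ F ⊙ extend^ (suc g + j ∸ i + h) one ⟩
    k  i = XPath (i + h) * ⟨ F ⊙ extend^ (g + suc j ∸ i) one ⟩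
    k′ i = XPath (i + h) * ⟨ F ⊙ extend^ (suc g + j ∸ i) one ⟩
    shift-f : ∀ i → f′ i ≡ f i
    shift-f i = cong (λ n → XPath i * ⟨ F ⊙ extend^ (n ∸ i + h) one ⟩) (sym (ℕ.+-suc g j))
    shift-k : ∀ i → k′ i ≡ k i
    shift-k i = cong (λ n → XPath (i + h) * ⟨ F ⊙ extend^ (n ∸ i) one ⟩) (sym (ℕ.+-suc g j))
    last-f : ⟨ a ⊙ b ⟩ ≡ ⟨ F ⊙ extend^ (g + suc j ∸ suc j + h) one ⟩
    last-f = trans (extend^-adjoint g h F one)
                   (cong (λ n → ⟨ F ⊙ extend^ (n + h) one ⟩) (sym (ℕ.m+n∸n≡m g (suc j))))
    last-k : ⟨ a ⟩ * ⟨ b ⊙ e ⟩ ≡ k (suc j)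
    last-k = begin
      ⟨ a ⟩ * ⟨ b ⊙ e ⟩
        ≡⟨ cong₂ _*_ (⟨extend^⟩ g F) (trans (extend^-adjoint h j one one) (⟨one⊙⟩ _)) ⟩
      ⟨ F ⊙ extend^ g one ⟩ * XPath (suc (h + j))
        ≡⟨ ℤ.*-comm ⟨ F ⊙ extend^ g one ⟩ (XPath (suc (h + j))) ⟩
      XPath (suc (h + j)) * ⟨ F ⊙ extend^ g one ⟩
        ≡⟨ cong₂ (λ p q → XPath (suc p) * ⟨ F ⊙ extend^ q one ⟩)
                 (ℕ.+-comm h j) (sym (ℕ.m+n∸n≡m g (suc j))) ⟩
      k (suc j) ∎

module Colourings (m : ℕ) (x : Fin m → ℤ) where
  open ColourFunctions m x

  Colouring : ℕ → Set
  Colouring k = Fin k → Fin m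

  ∑κ : ∀ k → (Colouring k → ℤ) → ℤ
  ∑κ k = ∑ (allFuns k m)

  weight : ∀ {k} → Colouring k → ℤ
  weight {k} κ = prodFin k (λ v → x (κ v))

  properSum : (G : Graph) → (Colouring (n G) → ℤ) → ℤ
  properSum G Φ = ∑κ (n G) (λ κ → ⟦ proper G κ ⟧ * (weight κ * Φ κ))

  properSum-cong : ∀ G {Φ Ψ : Colouring (n G) → ℤ} → (∀ κ → Φ κ ≡ Ψ κ) → properSum G Φ ≡ properSum G Ψ
  properSum-cong G Φ≗Ψ = ∑-cong (allFuns (n G) m) (λ κ → cong (λ t → ⟦ proper G κ ⟧ * (weight κ * t)) (Φ≗Ψ κ))

  X≡properSum : ∀ G → X G m x ≡ properSum G (λ _ → 1ℤ)
  X≡properSum G = ∑-cong (allFuns (n G) m) (λ κ → as-product (proper G κ) (weight κ))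
    where as-product : ∀ b w → (if b then w else 0ℤ) ≡ ⟦ b ⟧ * (w * 1ℤ)
          as-product true  w = sym (trans (ℤ.*-identityˡ (w * 1ℤ)) (ℤ.*-identityʳ w))
          as-product false w = refl

  ∑κ-cons : ∀ k (Φ : Colouring (suc k) → ℤ) → ∑κ (suc k) Φ ≡ ∑ᶜ (λ c → ∑κ k (λ κ → Φ (cons c κ)))
  ∑κ-cons k Φ = trans (∑-concatMap (allFin m) _ Φ) (∑-cong (allFin m) (λ c → ∑-map (allFuns k m) (cons c) Φ))

  -- insert and _++_ are built from cons, as allFuns is, so that ∑κ-insert and ∑κ-++ hold for
  -- every Φ without function extensionality (unlike Data.Vec.Functional's insertAt and _++_).
  insert : ∀ {k} → Fin (suc k) → Fin m → Colouring k → Colouring (suc k)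
  insert zero          c κ = cons c κ
  insert {suc k} (suc b) c κ = cons (κ zero) (insert b c (κ ∘ suc))

  insert-self : ∀ {k} (b : Fin (suc k)) c κ → insert b c κ b ≡ c
  insert-self zero          c κ = refl
  insert-self {suc k} (suc b) c κ = insert-self b c (κ ∘ suc)

  insert-punchOut : ∀ {k} (b j : Fin (suc k)) c κ (b≢j : b ≢ j) → insert b c κ j ≡ κ (punchOut b≢j)
  insert-punchOut zero    zero    c κ b≢j = ⊥-elim (b≢j refl)
  insert-punchOut zero    (suc j) c κ b≢j = refl
  insert-punchOut {suc k} (suc b) zero    c κ b≢j = refl
  insert-punchOut {suc k} (suc b) (suc j) c κ b≢j = insert-punchOut b j c (κ ∘ suc) (b≢j ∘ cong suc)

  ∑κ-insert : ∀ k (b : Fin (suc k)) (Φ : Colouring (suc k) → ℤ) →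
    ∑κ (suc k) Φ ≡ ∑ᶜ (λ c → ∑κ k (λ κ → Φ (insert b c κ)))
  ∑κ-insert k       zero    Φ = ∑κ-cons k Φ
  ∑κ-insert (suc k) (suc b) Φ = begin
    ∑κ (suc (suc k)) Φ
      ≡⟨ ∑κ-cons (suc k) Φ ⟩
    ∑ᶜ (λ d → ∑κ (suc k) (λ κ → Φ (cons d κ)))
      ≡⟨ ∑-cong (allFin m) (λ d → ∑κ-insert k b (λ κ → Φ (cons d κ))) ⟩
    ∑ᶜ (λ d → ∑ᶜ (λ c → ∑κ k (λ κ → Φ (cons d (insert b c κ)))))
      ≡⟨ ∑-comm (allFin m) (allFin m) _ ⟩
    ∑ᶜ (λ c → ∑ᶜ (λ d → ∑κ k (λ κ → Φ (cons d (insert b c κ)))))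
      ≡⟨ ∑-cong (allFin m) (λ c → sym (∑κ-cons k (λ κ → Φ (insert (suc b) c κ)))) ⟩
    ∑ᶜ (λ c → ∑κ (suc k) (λ κ → Φ (insert (suc b) c κ))) ∎

  weight-insert : ∀ k (b : Fin (suc k)) c κ → weight (insert b c κ) ≡ x c * weight κ
  weight-insert k       zero    c κ = refl
  weight-insert (suc k) (suc b) c κ =
    trans (cong (x (κ zero) *_) (weight-insert k b c (κ ∘ suc))) (swap (x (κ zero)) (x c) _)
    where swap : ∀ p q r → p * (q * r) ≡ q * (p * r)
          swap = solve-∀

  infixr 5 _++_
  _++_ : ∀ {k l} → Colouring k → Colouring l → Colouring (k + l)
  _++_ {zero}  κ λ′ = λ′
  _++_ {suc k} κ λ′ = cons (κ zero) ((κ ∘ suc) ++ λ′)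

  ++-↑ˡ : ∀ {k} l (κ : Colouring k) (λ′ : Colouring l) i → (κ ++ λ′) (i ↑ˡ l) ≡ κ i
  ++-↑ˡ l κ λ′ zero    = refl
  ++-↑ˡ l κ λ′ (suc i) = ++-↑ˡ l (κ ∘ suc) λ′ i

  ++-↑ʳ : ∀ k {l} (κ : Colouring k) (λ′ : Colouring l) j → (κ ++ λ′) (k ↑ʳ j) ≡ λ′ j
  ++-↑ʳ zero    κ λ′ j = refl
  ++-↑ʳ (suc k) κ λ′ j = ++-↑ʳ k (κ ∘ suc) λ′ j

  ∑κ-++ : ∀ k l (Φ : Colouring (k + l) → ℤ) → ∑κ (k + l) Φ ≡ ∑κ k (λ κ → ∑κ l (λ λ′ → Φ (κ ++ λ′)))
  ∑κ-++ zero    l Φ = sym (ℤ.+-identityʳ _)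
  ∑κ-++ (suc k) l Φ = begin
    ∑κ (suc (k + l)) Φ
      ≡⟨ ∑κ-cons (k + l) Φ ⟩
    ∑ᶜ (λ c → ∑κ (k + l) (λ κ → Φ (cons c κ)))
      ≡⟨ ∑-cong (allFin m) (λ c → ∑κ-++ k l (λ κ → Φ (cons c κ))) ⟩
    ∑ᶜ (λ c → ∑κ k (λ κ → ∑κ l (λ λ′ → Φ (cons c (κ ++ λ′)))))
      ≡⟨ sym (∑κ-cons k (λ κ → ∑κ l (λ λ′ → Φ (κ ++ λ′)))) ⟩
    ∑κ (suc k) (λ κ → ∑κ l (λ λ′ → Φ (κ ++ λ′))) ∎

  weight-++ : ∀ k {l} (κ : Colouring k) (λ′ : Colouring l) → weight (κ ++ λ′) ≡ weight κ * weight λ′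
  weight-++ zero    κ λ′ = sym (ℤ.*-identityˡ _)
  weight-++ (suc k) κ λ′ =
    trans (cong (x (κ zero) *_) (weight-++ k (κ ∘ suc) λ′)) (sym (ℤ.*-assoc (x (κ zero)) _ _))

  rootProfile : (B : Graph) → Fin (n B) → (Colouring (n B) → ℤ) → Fin m → ℤ
  rootProfile (mkGraph zero _) ()
  rootProfile B@(mkGraph (suc q) _) b χ c =
    ∑κ q (λ κ → ⟦ proper B (insert b c κ) ⟧ * (weight κ * χ (insert b c κ)))

  rootProfile-cong : ∀ B b {χ χ′ : Colouring (n B) → ℤ} → (∀ κ → χ κ ≡ χ′ κ) →
    rootProfile B b χ ≗ rootProfile B b χ′
  rootProfile-cong (mkGraph zero _) ()
  rootProfile-cong B@(mkGraph (suc q) _) b χ≗χ′ c = ∑-cong (allFuns q m) (λ κ →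
    cong (λ t → ⟦ proper B (insert b c κ) ⟧ * (weight κ * t)) (χ≗χ′ (insert b c κ)))

  rootProfile-*root : ∀ B b (f : Fin m → ℤ) (χ : Colouring (n B) → ℤ) c →
    rootProfile B b (λ κ → f (κ b) * χ κ) c ≡ f c * rootProfile B b χ c
  rootProfile-*root (mkGraph zero _) ()
  rootProfile-*root B@(mkGraph (suc q) _) b f χ c =
    trans (∑-cong (allFuns q m) (λ κ →
             trans (cong (λ d → ⟦ proper B (insert b c κ) ⟧ * (weight κ * (f d * χ (insert b c κ))))
                         (insert-self b c κ))
                   (swap ⟦ proper B (insert b c κ) ⟧ (weight κ) (f c) (χ (insert b c κ)))))
          (*-distribˡ-∑ (allFuns q m) (f c) _)
    where swap : ∀ p w s t → p * (w * (s * t)) ≡ s * (p * (w * t))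
          swap = solve-∀

  properSum-byRoot : ∀ B b (Φ : Colouring (n B) → ℤ) → properSum B Φ ≡ ∑ᶜ (λ c → x c * rootProfile B b Φ c)
  properSum-byRoot (mkGraph zero _) ()
  properSum-byRoot B@(mkGraph (suc q) _) b Φ =
    trans (∑κ-insert q b _) (∑-cong (allFin m) (λ c →
      trans (∑-cong (allFuns q m) (λ κ →
               trans (cong (λ w → ⟦ proper B (insert b c κ) ⟧ * (w * Φ (insert b c κ))) (weight-insert q b c κ))
                     (swap ⟦ proper B (insert b c κ) ⟧ (x c) (weight κ) (Φ (insert b c κ)))))
            (*-distribˡ-∑ (allFuns q m) (x c) _)))
    where swap : ∀ p s w t → p * (s * w * t) ≡ s * (p * (w * t))
          swap = solve-∀

  glue-restrictˡ : ∀ A a q adjB b (κ : Colouring (n A)) (λ′ : Colouring q) →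
    (κ ++ λ′) ∘ inl (glue A a (mkGraph (suc q) adjB) b) ≗ κ
  glue-restrictˡ A a q adjB b κ λ′ = ++-↑ˡ q κ λ′

  glue-restrictʳ : ∀ A a q adjB b (κ : Colouring (n A)) (λ′ : Colouring q) →
    (κ ++ λ′) ∘ inr (glue A a (mkGraph (suc q) adjB) b) ≗ insert b (κ a) λ′
  glue-restrictʳ A a q adjB b κ λ′ j with j Fin.≟ b
  ... | yes refl = trans (++-↑ˡ q κ λ′ a) (sym (insert-self b (κ a) λ′))
  ... | no j≢b   = trans (++-↑ʳ (n A) κ λ′ _) (sym (insert-punchOut b j (κ a) λ′ _))

  Extensional : ∀ {k} → (Colouring k → ℤ) → Set
  Extensional {k} ψ = ∀ {κ κ′ : Colouring k} → κ ≗ κ′ → ψ κ ≡ ψ κ′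

  properSum-glue : ∀ A a B b (ψ : Colouring (n A) → ℤ) (χ : Colouring (n B) → ℤ) →
    Extensional ψ → Extensional χ →
    properSum (G (glue A a B b)) (λ κ → ψ (κ ∘ inl (glue A a B b)) * χ (κ ∘ inr (glue A a B b)))
      ≡ properSum A (λ κ → ψ κ * rootProfile B b χ (κ a))
  properSum-glue A a (mkGraph zero _) ()
  properSum-glue A a B@(mkGraph (suc q) adjB) b ψ χ ψ-ext χ-ext = begin
    ∑κ (n A + q) summand
      ≡⟨ ∑κ-++ (n A) q summand ⟩
    ∑κ (n A) (λ κ → ∑κ q (λ λ′ → summand (κ ++ λ′)))
      ≡⟨ ∑-cong (allFuns (n A) m) (λ κ →
           trans (∑-cong (allFuns q m) (factor κ)) (*-distribˡ-∑ (allFuns q m) (⟦ proper A κ ⟧ * (weight κ * ψ κ)) _)) ⟩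
    ∑κ (n A) (λ κ → ⟦ proper A κ ⟧ * (weight κ * ψ κ) * rootProfile B b χ (κ a))
      ≡⟨ ∑-cong (allFuns (n A) m) (λ κ → ℤ.*-assoc ⟦ proper A κ ⟧ _ _) ⟩
    ∑κ (n A) (λ κ → ⟦ proper A κ ⟧ * (weight κ * ψ κ * rootProfile B b χ (κ a)))
      ≡⟨ ∑-cong (allFuns (n A) m) (λ κ → cong (⟦ proper A κ ⟧ *_) (ℤ.*-assoc (weight κ) _ _)) ⟩
    properSum A (λ κ → ψ κ * rootProfile B b χ (κ a)) ∎
    where
    W = glue A a B b
    summand : Colouring (n A + q) → ℤ
    summand κ = ⟦ proper (G W) κ ⟧ * (weight κ * (ψ (κ ∘ inl W) * χ (κ ∘ inr W)))
    factor : ∀ κ λ′ → summand (κ ++ λ′) ≡ ⟦ proper A κ ⟧ * (weight κ * ψ κ) *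
               (⟦ proper B (insert b (κ a) λ′) ⟧ * (weight λ′ * χ (insert b (κ a) λ′)))
    factor κ λ′ = begin
      summand (κ ++ λ′)
        ≡⟨ cong₂ (λ p w → p * (w * (ψ ((κ ++ λ′) ∘ inl W) * χ ((κ ++ λ′) ∘ inr W))))
                 (⟦proper-glue⟧ A a B b (κ ++ λ′)) (weight-++ (n A) κ λ′) ⟩
      ⟦ proper A ((κ ++ λ′) ∘ inl W) ⟧ * ⟦ proper B ((κ ++ λ′) ∘ inr W) ⟧ *
        (weight κ * weight λ′ * (ψ ((κ ++ λ′) ∘ inl W) * χ ((κ ++ λ′) ∘ inr W)))
        ≡⟨ cong₂ (λ p s → p * (weight κ * weight λ′ * s))
                 (cong₂ (λ p p′ → ⟦ p ⟧ * ⟦ p′ ⟧) (proper-cong A restrictˡ) (proper-cong B restrictʳ))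
                 (cong₂ _*_ (ψ-ext restrictˡ) (χ-ext restrictʳ)) ⟩
      ⟦ proper A κ ⟧ * ⟦ proper B κB ⟧ * (weight κ * weight λ′ * (ψ κ * χ κB))
        ≡⟨ regroup ⟦ proper A κ ⟧ ⟦ proper B κB ⟧ (weight κ) (weight λ′) (ψ κ) (χ κB) ⟩
      ⟦ proper A κ ⟧ * (weight κ * ψ κ) * (⟦ proper B κB ⟧ * (weight λ′ * χ κB)) ∎
      where
      κB = insert b (κ a) λ′
      restrictˡ = glue-restrictˡ A a q adjB b κ λ′
      restrictʳ = glue-restrictʳ A a q adjB b κ λ′
      regroup : ∀ p p′ w w′ s t → p * p′ * (w * w′ * (s * t)) ≡ p * (w * s) * (p′ * (w′ * t))
      regroup = solve-∀

  profile : RGraph → Fin m → ℤ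
  profile R = rootProfile (graph R) (root R) (λ _ → 1ℤ)

  properSum-root : ∀ R (f : Fin m → ℤ) → properSum (graph R) (λ κ → f (κ (root R))) ≡ ⟨ f ⊙ profile R ⟩
  properSum-root R f = trans (properSum-byRoot (graph R) (root R) _) (∑-cong (allFin m) (λ c → cong (x c *_)
    (trans (rootProfile-cong (graph R) (root R) (λ κ → sym (ℤ.*-identityʳ (f (κ (root R))))) c)
           (rootProfile-*root (graph R) (root R) f (λ _ → 1ℤ) c))))

  glue-root : ∀ A a R (ψ : Colouring (n A) → ℤ) → Extensional ψ →
    properSum (G (glue A a (graph R) (root R))) (λ κ → ψ (κ ∘ inl (glue A a (graph R) (root R))))
      ≡ properSum A (λ κ → ψ κ * profile R (κ a))
  glue-root A a R ψ ψ-ext =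
    trans (properSum-cong (G (glue A a (graph R) (root R))) (λ κ → sym (ℤ.*-identityʳ _)))
          (properSum-glue A a (graph R) (root R) ψ (λ _ → 1ℤ) ψ-ext (λ _ → refl))

  rootProfile-path : ∀ k (f : Fin m → ℤ) → rootProfile (P (suc k)) zero (λ κ → f (κ (fromℕ k))) ≗ extend^ k f
  rootProfile-path zero    f c = unit (f c)
    where unit : ∀ v → 1ℤ * (1ℤ * v) ℤ.+ 0ℤ ≡ v
          unit = solve-∀
  rootProfile-path (suc k) f c = begin
    ∑κ (suc k) (λ κ → ⟦ proper (P (suc (suc k))) (cons c κ) ⟧ * (weight κ * f (κ (fromℕ k))))
      ≡⟨ ∑κ-cons k _ ⟩
    ∑ᶜ (λ d → ∑κ k (λ κ → ⟦ proper (P (suc (suc k))) (cons c (cons d κ)) ⟧ * (x d * weight κ * f′ (cons d κ))))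
      ≡⟨ ∑-cong (allFin m) (λ d → trans (∑-cong (allFuns k m) (split-edge d))
                                              (*-distribˡ-∑ (allFuns k m) (⟦ not ⌊ c Fin.≟ d ⌋ ⟧ * x d) _)) ⟩
    ∑ᶜ (λ d → ⟦ not ⌊ c Fin.≟ d ⌋ ⟧ * x d * rootProfile (P (suc k)) zero (λ κ → f (κ (fromℕ k))) d)
      ≡⟨ ∑-cong (allFin m) (λ d → trans (cong (⟦ not ⌊ c Fin.≟ d ⌋ ⟧ * x d *_) (rootProfile-path k f d))
                                        (ℤ.*-assoc ⟦ not ⌊ c Fin.≟ d ⌋ ⟧ (x d) (extend^ k f d))) ⟩
    ∑ᶜ (λ d → ⟦ not ⌊ c Fin.≟ d ⌋ ⟧ * (x d * extend^ k f d))
      ≡⟨ ∑-allFin-except m c (λ d → x d * extend^ k f d) ⟩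
    extend (extend^ k f) c ∎
    where
    f′ : Colouring (suc k) → ℤ
    f′ κ = f (κ (fromℕ k))
    split-edge : ∀ d κ → ⟦ proper (P (suc (suc k))) (cons c (cons d κ)) ⟧ * (x d * weight κ * f′ (cons d κ))
      ≡ ⟦ not ⌊ c Fin.≟ d ⌋ ⟧ * x d * (⟦ proper (P (suc k)) (cons d κ) ⟧ * (weight κ * f′ (cons d κ)))
    split-edge d κ = trans (cong (_* (x d * weight κ * f′ (cons d κ))) (⟦proper-path⟧ k (cons c (cons d κ))))
                           (regroup ⟦ not ⌊ c Fin.≟ d ⌋ ⟧ ⟦ proper (P (suc k)) (cons d κ) ⟧ (x d) (weight κ) (f′ (cons d κ)))
      where regroup : ∀ e p s w t → e * p * (s * w * t) ≡ e * s * (p * (w * t))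
            regroup = solve-∀

  properSum-path : ∀ k (g f : Fin m → ℤ) →
    properSum (P (suc k)) (λ κ → g (κ zero) * f (κ (fromℕ k))) ≡ ⟨ g ⊙ extend^ k f ⟩
  properSum-path k g f = trans (properSum-byRoot (P (suc k)) zero _) (∑-cong (allFin m) (λ c → cong (x c *_)
    (trans (rootProfile-*root (P (suc k)) zero g (λ κ → f (κ (fromℕ k))) c)
           (cong (g c *_) (rootProfile-path k f c)))))

  glue-path : ∀ A a k (ψ : Colouring (n A) → ℤ) (f : Fin m → ℤ) → Extensional ψ →
    let W = glue A a (P (suc k)) zero in
    properSum (G W) (λ κ → ψ (κ ∘ inl W) * f (κ (inr W (fromℕ k))))
      ≡ properSum A (λ κ → ψ κ * extend^ k f (κ a))
  glue-path A a k ψ f ψ-ext =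
    trans (properSum-glue A a (P (suc k)) zero ψ (λ κ → f (κ (fromℕ k))) ψ-ext (λ κ≗κ′ → cong f (κ≗κ′ (fromℕ k))))
          (properSum-cong A (λ κ → cong (ψ κ *_) (rootProfile-path k f (κ a))))

  X-path : ∀ i → X (P i) m x ≡ XPath i
  X-path zero    = refl
  X-path (suc k) = trans (X≡properSum (P (suc k))) (trans (properSum-path k one one) (⟨one⊙⟩ (extend^ k one)))

  X-Pk : ∀ k R₁ R₂ → X (Pk k R₁ R₂) m x ≡ ⟨ profile R₁ ⊙ extend^ k (profile R₂) ⟩
  X-Pk k R₁ R₂ = begin
    X (G W₂) m x
      ≡⟨ X≡properSum (G W₂) ⟩
    properSum (G W₂) (λ _ → 1ℤ)
      ≡⟨ glue-root (G W₁) (inr W₁ (fromℕ k)) R₂ (λ _ → 1ℤ) (λ _ → refl) ⟩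
    properSum (G W₁) (λ κ → 1ℤ * F₂ (κ (inr W₁ (fromℕ k))))
      ≡⟨ glue-path (graph R₁) (root R₁) k (λ _ → 1ℤ) F₂ (λ _ → refl) ⟩
    properSum (graph R₁) (λ κ → 1ℤ * extend^ k F₂ (κ (root R₁)))
      ≡⟨ properSum-cong (graph R₁) (λ κ → ℤ.*-identityˡ _) ⟩
    properSum (graph R₁) (λ κ → extend^ k F₂ (κ (root R₁)))
      ≡⟨ properSum-root R₁ (extend^ k F₂) ⟩
    ⟨ extend^ k F₂ ⊙ profile R₁ ⟩
      ≡⟨ ⟨⊙⟩-comm (extend^ k F₂) (profile R₁) ⟩
    ⟨ profile R₁ ⊙ extend^ k F₂ ⟩ ∎
    where
    F₂ = profile R₂
    W₁ = glue (graph R₁) (root R₁) (P (suc k)) zero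
    W₂ = glue (G W₁) (inr W₁ (fromℕ k)) (graph R₂) (root R₂)

  X-tail : ∀ R k → X (tail R k) m x ≡ ⟨ profile R ⊙ extend^ k one ⟩
  X-tail R k = X-Pk k R K1r

  properSum-legs : ∀ t₁ t₂ t₃ (f₁ f₂ f₃ : Fin m → ℤ) →
    let W₁ = glue (P (suc t₁)) zero (P (suc t₂)) zero
        W₂ = glue (G W₁) (inl W₁ zero) (P (suc t₃)) zero
    in properSum (G W₂) (λ κ → f₁ (κ (inl W₂ (inl W₁ (fromℕ t₁)))) * f₂ (κ (inl W₂ (inr W₁ (fromℕ t₂))))
                                * f₃ (κ (inr W₂ (fromℕ t₃))))
         ≡ ⟨ extend^ t₁ f₁ ⊙ extend^ t₂ f₂ ⊙ extend^ t₃ f₃ ⟩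
  properSum-legs t₁ t₂ t₃ f₁ f₂ f₃ = begin
    properSum (G W₂) (λ κ → ψ₂ (κ ∘ inl W₂) * f₃ (κ (inr W₂ (fromℕ t₃))))
      ≡⟨ glue-path (G W₁) (inl W₁ zero) t₃ ψ₂ f₃ (λ κ≗κ′ → cong₂ (λ c d → f₁ c * f₂ d) (κ≗κ′ _) (κ≗κ′ _)) ⟩
    properSum (G W₁) (λ κ → ψ₂ κ * E₃ (κ (inl W₁ zero)))
      ≡⟨ properSum-cong (G W₁) (λ κ → rotate (f₁ (κ (inl W₁ (fromℕ t₁)))) (f₂ (κ (inr W₁ (fromℕ t₂)))) _) ⟩
    properSum (G W₁) (λ κ → ψ₁ (κ ∘ inl W₁) * f₂ (κ (inr W₁ (fromℕ t₂))))
      ≡⟨ glue-path (P (suc t₁)) zero t₂ ψ₁ f₂ (λ κ≗κ′ → cong₂ (λ c d → E₃ c * f₁ d) (κ≗κ′ _) (κ≗κ′ _)) ⟩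
    properSum (P (suc t₁)) (λ κ → ψ₁ κ * E₂ (κ zero))
      ≡⟨ properSum-cong (P (suc t₁)) (λ κ → rotate (E₃ (κ zero)) (f₁ (κ (fromℕ t₁))) (E₂ (κ zero))) ⟩
    properSum (P (suc t₁)) (λ κ → E₂ (κ zero) * E₃ (κ zero) * f₁ (κ (fromℕ t₁)))
      ≡⟨ properSum-path t₁ (E₂ ⊙ E₃) f₁ ⟩
    ⟨ E₂ ⊙ E₃ ⊙ extend^ t₁ f₁ ⟩
      ≡⟨ ⟨⟩-cong (λ c → rotate (E₂ c) (E₃ c) (extend^ t₁ f₁ c)) ⟩
    ⟨ extend^ t₁ f₁ ⊙ E₂ ⊙ E₃ ⟩ ∎
    where
    W₁ = glue (P (suc t₁)) zero (P (suc t₂)) zero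
    W₂ = glue (G W₁) (inl W₁ zero) (P (suc t₃)) zero
    E₂ = extend^ t₂ f₂
    E₃ = extend^ t₃ f₃
    ψ₂ : Colouring (n (G W₁)) → ℤ
    ψ₂ κ = f₁ (κ (inl W₁ (fromℕ t₁))) * f₂ (κ (inr W₁ (fromℕ t₂)))
    ψ₁ : Colouring (suc t₁) → ℤ
    ψ₁ κ = E₃ (κ zero) * f₁ (κ (fromℕ t₁))
    rotate : ∀ p q r → p * q * r ≡ r * p * q
    rotate = solve-∀

  X-spider : ∀ t₁ t₂ t₃ R₁ R₂ R₃ → X (S t₁ t₂ t₃ R₁ R₂ R₃) m x
    ≡ ⟨ extend^ t₁ (profile R₁) ⊙ extend^ t₂ (profile R₂) ⊙ extend^ t₃ (profile R₃) ⟩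
  X-spider t₁ t₂ t₃ R₁ R₂ R₃ = begin
    X (G W₅) m x
      ≡⟨ X≡properSum (G W₅) ⟩
    properSum (G W₅) (λ _ → 1ℤ)
      ≡⟨ glue-root (G W₄) (inl W₄ (inl W₃ e₃)) R₃ (λ _ → 1ℤ) (λ _ → refl) ⟩
    properSum (G W₄) (λ κ → ψ₄ (κ ∘ inl W₄))
      ≡⟨ glue-root (G W₃) (inl W₃ e₂) R₂ ψ₄ (λ κ≗κ′ → cong (λ c → 1ℤ * F₃ c) (κ≗κ′ _)) ⟩
    properSum (G W₃) (λ κ → ψ₃ (κ ∘ inl W₃))
      ≡⟨ glue-root (G W₂) e₁ R₁ ψ₃ (λ κ≗κ′ → cong₂ (λ c d → 1ℤ * F₃ c * F₂ d) (κ≗κ′ _) (κ≗κ′ _)) ⟩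
    properSum (G W₂) (λ κ → 1ℤ * F₃ (κ e₃) * F₂ (κ e₂) * F₁ (κ e₁))
      ≡⟨ properSum-cong (G W₂) (λ κ → reorder (F₁ (κ e₁)) (F₂ (κ e₂)) (F₃ (κ e₃))) ⟩
    properSum (G W₂) (λ κ → F₁ (κ e₁) * F₂ (κ e₂) * F₃ (κ e₃))
      ≡⟨ properSum-legs t₁ t₂ t₃ F₁ F₂ F₃ ⟩
    ⟨ extend^ t₁ F₁ ⊙ extend^ t₂ F₂ ⊙ extend^ t₃ F₃ ⟩ ∎
    where
    F₁ = profile R₁
    F₂ = profile R₂
    F₃ = profile R₃
    W₁ = glue (P (suc t₁)) zero (P (suc t₂)) zero
    W₂ = glue (G W₁) (inl W₁ zero) (P (suc t₃)) zero
    e₁ = inl W₂ (inl W₁ (fromℕ t₁))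
    e₂ = inl W₂ (inr W₁ (fromℕ t₂))
    e₃ = inr W₂ (fromℕ t₃)
    W₃ = glue (G W₂) e₁ (graph R₁) (root R₁)
    W₄ = glue (G W₃) (inl W₃ e₂) (graph R₂) (root R₂)
    W₅ = glue (G W₄) (inl W₄ (inl W₃ e₃)) (graph R₃) (root R₃)
    ψ₄ : Colouring (n (G W₃)) → ℤ
    ψ₄ κ = 1ℤ * F₃ (κ (inl W₃ e₃))
    ψ₃ : Colouring (n (G W₂)) → ℤ
    ψ₃ κ = 1ℤ * F₃ (κ e₃) * F₂ (κ e₂)
    reorder : ∀ a b c → 1ℤ * c * b * a ≡ a * b * c
    reorder = solve-∀

corollary4p3 : (G H : RGraph) → IsSimple (graph G) → IsSimple (graph H) →
    (g j h : ℕ) → 1 ≤ h → (m : ℕ) → (x : Fin m → ℤ) →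
    (X (S₂ g h j G H) m x
      ≡ Σ₀ j (λ i → X (P i) m x * X (Pk (g + h + j ∸ i) G H) m x)
        - Σ₁ j (λ i → X (tail G (g + i ∸ 1)) m x * X (tail H (h + j ∸ i)) m x))
    ×
    (X (S₁ g h j G) m x
      ≡ Σ₀ j (λ i → X (P i) m x * X (tail G (g + j ∸ i + h)) m x)
        - Σ₁ j (λ i → X (P (i + h)) m x * X (tail G (g + j ∸ i)) m x))
corollary4p3 G H _ _ g j h _ m x =
  trans (X-spider g h j G H K1r)
    (trans (spider-expansion₁ (profile G) (profile H) g j h)
      (sym (cong₂ _-_ (Σ₀-cong j (λ i → cong₂ _*_ (X-path i) (X-Pk (g + h + j ∸ i) G H)))
                      (Σ₁-cong j (λ i → cong₂ _*_ (X-tail G (g + i ∸ 1)) (X-tail H (h + j ∸ i))))))) ,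
  trans (X-spider g h j G K1r K1r)
    (trans (spider-expansion₂ (profile G) g j h)
      (sym (cong₂ _-_ (Σ₀-cong j (λ i → cong₂ _*_ (X-path i) (X-tail G (g + j ∸ i + h))))
                      (Σ₁-cong j (λ i → cong₂ _*_ (X-path (i + h)) (X-tail G (g + j ∸ i)))))))
  where
  open ColourFunctions m x
  open Colourings m x
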